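{- Let $G$ be a finite simple graph of order $n$ and size $m$, where $0 \le m \le n-1$. Then $$\sigma(G)\le m(m-1)^2,$$ with equality if and only if either $m=0$ and $G$ is the edgeless graph, or $m\ge 1$ and $G$ consists of the star $S_{m+1}$ together with $n-m-1$ isolated vertices.
   Context: For a graph $G$ with edge set $E(G)$ and $d_w$ denoting the degree of a vertex $w$, the sigma index is $\sigma(G)=\sum_{uv\in E(G)}(d_u-d_v)^2$. The star $S_r$ is the graph on $r$ vertices consisting of one vertex adjacent to all the other $r-1$ vertices and no other edges. An isolated vertex is a vertex of degree $0$; an edgeless graph is a graph with no edges. -}

module Defs where

open import Data.Nat using (ℕ; zero; suc; _+_; _*_; _∸_; _^_; _≤_; _<ᵇ_; _≤ᵇ_; _≡ᵇ_; ∣_-_∣)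
open import Data.Bool using (Bool; true; false; _∧_; _∨_; if_then_else_)
open import Data.Fin using (Fin; toℕ)
open import Data.Fin.Permutation using (Permutation′; _⟨$⟩ʳ_)
open import Relation.Binary.PropositionalEquality using (_≡_)
open import Data.Product using (Σ)

record Graph (n : ℕ) : Set where
  field
    adj     : Fin n → Fin n → Bool
    adj-sym : ∀ i j → adj i j ≡ adj j i
    irrefl  : ∀ i → adj i i ≡ false
open Graph public

∑ : ∀ {n} → (Fin n → ℕ) → ℕ
∑ {zero}  f = 0
∑ {suc n} f = f Fin.zero + ∑ (λ i → f (Fin.suc i))

b2n : Bool → ℕ
b2n true  = 1
b2n false = 0

deg : ∀ {n} → Graph n → Fin n → ℕ
deg G i = ∑ (λ j → b2n (adj G i j))

-- each edge {i,j} is counted once, as the pair with toℕ i < toℕ j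
isEdge< : ∀ {n} → Graph n → Fin n → Fin n → Bool
isEdge< G i j = (toℕ i <ᵇ toℕ j) ∧ adj G i j

size : ∀ {n} → Graph n → ℕ
size G = ∑ (λ i → ∑ (λ j → b2n (isEdge< G i j)))

sigma : ∀ {n} → Graph n → ℕ
sigma G = ∑ (λ i → ∑ (λ j → b2n (isEdge< G i j) * (∣ deg G i - deg G j ∣ ^ 2)))

Edgeless : ∀ {n} → Graph n → Set
Edgeless G = ∀ i j → adj G i j ≡ false

_≅_ : ∀ {n} → Graph n → Graph n → Set
_≅_ {n} G H = Σ (Permutation′ n) (λ π → ∀ i j → adj G i j ≡ adj H (π ⟨$⟩ʳ i) (π ⟨$⟩ʳ j))

-- The standard graph on Fin n: star S_{m+1} with centre 0 and leaves 1..m,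
-- plus the remaining n - m - 1 vertices isolated.
starAdj : ℕ → ℕ → ℕ → Bool
starAdj m a b = ((a ≡ᵇ 0) ∧ (1 ≤ᵇ b) ∧ (b ≤ᵇ m)) ∨ ((b ≡ᵇ 0) ∧ (1 ≤ᵇ a) ∧ (a ≤ᵇ m))

private
  ∨-comm' : ∀ x y → (x ∨ y) ≡ (y ∨ x)
  ∨-comm' true true = _≡_.refl
  ∨-comm' true false = _≡_.refl
  ∨-comm' false true = _≡_.refl
  ∨-comm' false false = _≡_.refl

  starSym : ∀ m a b → starAdj m a b ≡ starAdj m b a
  starSym m a b = ∨-comm' ((a ≡ᵇ 0) ∧ (1 ≤ᵇ b) ∧ (b ≤ᵇ m)) ((b ≡ᵇ 0) ∧ (1 ≤ᵇ a) ∧ (a ≤ᵇ m))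

  starIrr : ∀ m a → starAdj m a a ≡ false
  starIrr m zero = _≡_.refl
  starIrr m (suc a) = _≡_.refl

StarPlusIsolated : (n m : ℕ) → Graph n
StarPlusIsolated n m = record
  { adj = λ i j → starAdj m (toℕ i) (toℕ j)
  ; adj-sym = λ i j → starSym m (toℕ i) (toℕ j)
  ; irrefl = λ i → starIrr m (toℕ i)
  }

{-# OPTIONS --safe #-}
module Submission where

-- Write m for the size of G. For a vertex c, every edge either contains c or
-- avoids c, so m = deg c + (number of edges avoiding c); in particular all
-- degrees are at most m, and the endpoints of an edge have degrees in [1, m],
-- so each summand of sigma is at most (m − 1)². If sigma attains m (m − 1)²
-- with m ≥ 1, every summand is extremal, so some edge has an endpoint c of
-- degree m. Then no edge avoids c: G is a star centred at c, and listing the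
-- neighbours of c right after c is an isomorphism onto S_{m+1} plus isolated
-- vertices. Conversely, in such a star every edge joins degrees m and 1.

open import Defs
open import Data.Nat using (ℕ; _*_; _∸_; _^_; _≤_)
open import Data.Product using (_×_)
open import Data.Sum using (_⊎_)
open import Function.Bundles using (_⇔_)
open import Relation.Binary.PropositionalEquality using (_≡_)

open import Data.Bool using (Bool; true; false)
open import Data.Bool.Properties using (∨-identityʳ; ∧-zeroʳ; T-≡)
open import Data.Empty using (⊥-elim)
open import Data.Fin as Fin using (Fin; toℕ; punchIn; punchOut; fromℕ<)
open import Data.Fin.Permutation as Perm
  using (Permutation′; _⟨$⟩ʳ_; _⟨$⟩ˡ_; insert; insert-punchIn; lift₀; inverseˡ)
open import Data.Fin.Properties using (toℕ-injective; toℕ-fromℕ<; punchInᵢ≢i; punchIn-punchOut)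
open import Data.Nat using (zero; suc; _+_; _<_; _<ᵇ_; z≤n; s≤s; ∣_-_∣)
open import Data.Nat.Properties
open import Algebra.Properties.CommutativeSemigroup +-commutativeSemigroup
  using (interchange; x∙yz≈y∙xz)
open import Data.Product using (∃; _,_; proj₁; proj₂)
open import Data.Sum using (inj₁; inj₂)
open import Function.Base using (_∘_)
open import Function.Bundles using (mk⇔; Equivalence)
open import Relation.Binary.Definitions using (tri<; tri≈; tri>)
open import Relation.Binary.PropositionalEquality
  using (_≢_; refl; sym; trans; cong; cong₂; subst; module ≡-Reasoning)
open import Relation.Nullary using (yes; no)

-- Sums over Fin n

∑-cong : ∀ {n} {f g : Fin n → ℕ} → (∀ i → f i ≡ g i) → ∑ f ≡ ∑ g
∑-cong {zero}  f≗g = refl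
∑-cong {suc n} f≗g = cong₂ _+_ (f≗g Fin.zero) (∑-cong (f≗g ∘ Fin.suc))

∑-mono-≤ : ∀ {n} {f g : Fin n → ℕ} → (∀ i → f i ≤ g i) → ∑ f ≤ ∑ g
∑-mono-≤ {zero}  f≤g = z≤n
∑-mono-≤ {suc n} f≤g = +-mono-≤ (f≤g Fin.zero) (∑-mono-≤ (f≤g ∘ Fin.suc))

∑-zero : ∀ n → ∑ {n} (λ _ → 0) ≡ 0
∑-zero zero    = refl
∑-zero (suc n) = ∑-zero n

∑-distrib-+ : ∀ {n} (f g : Fin n → ℕ) → ∑ (λ i → f i + g i) ≡ ∑ f + ∑ g
∑-distrib-+ {zero}  f g = refl
∑-distrib-+ {suc n} f g = begin
  (f₀ + g₀) + ∑ (λ i → f (Fin.suc i) + g (Fin.suc i)) ≡⟨ cong (f₀ + g₀ +_) (∑-distrib-+ (f ∘ Fin.suc) (g ∘ Fin.suc)) ⟩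
  (f₀ + g₀) + (∑ (f ∘ Fin.suc) + ∑ (g ∘ Fin.suc))     ≡⟨ interchange f₀ g₀ _ _ ⟩
  (f₀ + ∑ (f ∘ Fin.suc)) + (g₀ + ∑ (g ∘ Fin.suc))     ∎
  where
  open ≡-Reasoning
  f₀ g₀ : ℕ
  f₀ = f Fin.zero
  g₀ = g Fin.zero

∑-distribʳ-* : ∀ {n} (f : Fin n → ℕ) c → ∑ (λ i → f i * c) ≡ ∑ f * c
∑-distribʳ-* {zero}  f c = refl
∑-distribʳ-* {suc n} f c = trans (cong (f Fin.zero * c +_) (∑-distribʳ-* (f ∘ Fin.suc) c))
                                 (sym (*-distribʳ-+ c (f Fin.zero) (∑ (f ∘ Fin.suc))))

∑-remove : ∀ {n} (f : Fin (suc n) → ℕ) i → ∑ f ≡ f i + ∑ (f ∘ punchIn i)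
∑-remove         f Fin.zero    = refl
∑-remove {suc n} f (Fin.suc i) = begin
  f₀ + ∑ (f ∘ Fin.suc)                               ≡⟨ cong (f₀ +_) (∑-remove (f ∘ Fin.suc) i) ⟩
  f₀ + (f (Fin.suc i) + ∑ (f ∘ Fin.suc ∘ punchIn i)) ≡⟨ x∙yz≈y∙xz f₀ (f (Fin.suc i)) _ ⟩
  f (Fin.suc i) + (f₀ + ∑ (f ∘ Fin.suc ∘ punchIn i)) ∎
  where
  open ≡-Reasoning
  f₀ : ℕ
  f₀ = f Fin.zero

term≤∑ : ∀ {n} (f : Fin n → ℕ) i → f i ≤ ∑ f
term≤∑ {suc n} f i = subst (f i ≤_) (sym (∑-remove f i)) (m≤m+n (f i) _)

∑≡0⇒≡0 : ∀ {n} (f : Fin n → ℕ) → ∑ f ≡ 0 → ∀ i → f i ≡ 0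
∑≡0⇒≡0 {suc n} f ∑f≡0 i = m+n≡0⇒m≡0 (f i) (trans (sym (∑-remove f i)) ∑f≡0)

∑>0⇒∃>0 : ∀ {n} (f : Fin n → ℕ) → 0 < ∑ f → ∃ λ i → 0 < f i
∑>0⇒∃>0 {suc n} f ∑f>0 with f Fin.zero in f₀≡
... | suc _ = Fin.zero , subst (0 <_) (sym f₀≡) (s≤s z≤n)
... | zero  = let i , fᵢ>0 = ∑>0⇒∃>0 (f ∘ Fin.suc) ∑f>0 in Fin.suc i , fᵢ>0

m≤n∧o≤p∧m+o≡n+p⇒m≡n : ∀ {m n o p} → m ≤ n → o ≤ p → m + o ≡ n + p → m ≡ n
m≤n∧o≤p∧m+o≡n+p⇒m≡n {m} {n} {o} m≤n o≤p eq =
  ≤-antisym m≤n (+-cancelʳ-≤ o n m (≤-trans (+-monoʳ-≤ n o≤p) (≤-reflexive (sym eq))))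

pointwise-≤∧∑≡⇒≡ : ∀ {n} {f g : Fin n → ℕ} → (∀ i → f i ≤ g i) → ∑ f ≡ ∑ g → ∀ i → f i ≡ g i
pointwise-≤∧∑≡⇒≡ {suc n} {f} {g} f≤g ∑f≡∑g i =
  m≤n∧o≤p∧m+o≡n+p⇒m≡n (f≤g i) (∑-mono-≤ (f≤g ∘ punchIn i))
    (trans (sym (∑-remove f i)) (trans ∑f≡∑g (∑-remove g i)))

count : ∀ {k} → (Fin k → Bool) → ℕ
count P = ∑ (b2n ∘ P)

b2n≤1 : ∀ b → b2n b ≤ 1
b2n≤1 true  = ≤-refl
b2n≤1 false = z≤n

count≤n : ∀ {n} (P : Fin n → Bool) → count P ≤ n
count≤n {zero}  P = z≤n
count≤n {suc n} P = +-mono-≤ (b2n≤1 (P Fin.zero)) (count≤n (P ∘ Fin.suc))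

b2n≡0⇒false : ∀ {b} → b2n b ≡ 0 → b ≡ false
b2n≡0⇒false {false} _ = refl

b2n>0⇒true : ∀ {b} → 0 < b2n b → b ≡ true
b2n>0⇒true {true} _ = refl

<⇒<ᵇ≡true : ∀ {m n} → m < n → (m <ᵇ n) ≡ true
<⇒<ᵇ≡true = Equivalence.to T-≡ ∘ <⇒<ᵇ

≤⇒<ᵇ≡false : ∀ {m n} → n ≤ m → (m <ᵇ n) ≡ false
≤⇒<ᵇ≡false z≤n       = refl
≤⇒<ᵇ≡false (s≤s n≤m) = ≤⇒<ᵇ≡false n≤m

n<ᵇn≡false : ∀ n → (n <ᵇ n) ≡ false
n<ᵇn≡false n = ≤⇒<ᵇ≡false (≤-refl {n})

^2-injective : ∀ {a b} → a ^ 2 ≡ b ^ 2 → a ≡ b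
^2-injective {a} {b} a²≡b² with <-cmp a b
... | tri≈ _ a≡b _ = a≡b
... | tri< a<b _ _ = ⊥-elim (<-irrefl a²≡b² (^-monoˡ-< 2 a<b))
... | tri> _ _ a>b = ⊥-elim (<-irrefl (sym a²≡b²) (^-monoˡ-< 2 a>b))

∣x-y∣≤M∸1 : ∀ {x y M} → 1 ≤ x → x ≤ M → 1 ≤ y → y ≤ M → ∣ x - y ∣ ≤ M ∸ 1
∣x-y∣≤M∸1 {x} {y} 1≤x x≤M 1≤y y≤M with ≤-total x y
... | inj₁ x≤y = subst (_≤ _) (sym (m≤n⇒∣m-n∣≡n∸m x≤y)) (∸-mono y≤M 1≤x)
... | inj₂ y≤x = subst (_≤ _) (sym (m≤n⇒∣n-m∣≡n∸m y≤x)) (∸-mono x≤M 1≤y)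

y∸x≡M∸1⇒y≡M : ∀ {x y M} → 1 ≤ x → x ≤ y → y ≤ M → y ∸ x ≡ M ∸ 1 → y ≡ M
y∸x≡M∸1⇒y≡M {x} {y} {M} 1≤x x≤y y≤M eq = ≤-antisym y≤M (begin
  M           ≡⟨ m∸n+n≡m (≤-trans 1≤x (≤-trans x≤y y≤M)) ⟨
  M ∸ 1 + 1   ≤⟨ +-monoʳ-≤ (M ∸ 1) 1≤x ⟩
  M ∸ 1 + x   ≡⟨ cong (_+ x) eq ⟨
  y ∸ x + x   ≡⟨ m∸n+n≡m x≤y ⟩
  y           ∎)
  where open ≤-Reasoning

∣x-y∣≡M∸1⇒x≡M⊎y≡M : ∀ {x y M} → 1 ≤ x → x ≤ M → 1 ≤ y → y ≤ M → ∣ x - y ∣ ≡ M ∸ 1 → x ≡ M ⊎ y ≡ M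
∣x-y∣≡M∸1⇒x≡M⊎y≡M {x} {y} 1≤x x≤M 1≤y y≤M eq with ≤-total x y
... | inj₁ x≤y = inj₂ (y∸x≡M∸1⇒y≡M 1≤x x≤y y≤M (trans (sym (m≤n⇒∣m-n∣≡n∸m x≤y)) eq))
... | inj₂ y≤x = inj₁ (y∸x≡M∸1⇒y≡M 1≤y y≤x x≤M (trans (sym (m≤n⇒∣n-m∣≡n∸m y≤x)) eq))

-- Fin and permutations

data PunchInView {k} (c : Fin (suc k)) : Fin (suc k) → Set where
  here    : PunchInView c c
  punched : ∀ a → PunchInView c (punchIn c a)

punchInView : ∀ {k} (c a : Fin (suc k)) → PunchInView c a
punchInView c a with c Fin.≟ a
... | yes refl = here
... | no c≢a   = subst (PunchInView c) (punchIn-punchOut c≢a) (punched (punchOut c≢a))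

insert-self : ∀ {k} (i j : Fin (suc k)) (π : Permutation′ k) → insert i j π ⟨$⟩ʳ i ≡ j
insert-self i j π with i Fin.≟ i
... | yes _  = refl
... | no i≢i = ⊥-elim (i≢i refl)

toℕ-punchIn-<ᵇ : ∀ {k} (p : Fin (suc k)) (x : Fin k) → (toℕ (punchIn p x) <ᵇ toℕ p) ≡ (toℕ x <ᵇ toℕ p)
toℕ-punchIn-<ᵇ Fin.zero    x           = refl
toℕ-punchIn-<ᵇ (Fin.suc p) Fin.zero    = refl
toℕ-punchIn-<ᵇ (Fin.suc p) (Fin.suc x) = toℕ-punchIn-<ᵇ p x

-- By induction on k: the first element goes to the front (lift₀) if it
-- satisfies P, and to position count P of the rest (insert) otherwise.
trues-first : ∀ k (P : Fin k → Bool) →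
  ∃ λ (ρ : Permutation′ k) → ∀ x → P x ≡ (toℕ (ρ ⟨$⟩ʳ x) <ᵇ count P)
trues-first zero    P = Perm.id , λ ()
trues-first (suc k) P with trues-first k (P ∘ Fin.suc) | P Fin.zero in P₀≡
... | ρ , ρ-sorts | true = lift₀ ρ , sorts
  where
  sorts : ∀ x → P x ≡ (toℕ (lift₀ ρ ⟨$⟩ʳ x) <ᵇ suc (count (P ∘ Fin.suc)))
  sorts Fin.zero    = P₀≡
  sorts (Fin.suc x) = ρ-sorts x
... | ρ , ρ-sorts | false = insert Fin.zero p ρ , sorts
  where
  c : ℕ
  c = count (P ∘ Fin.suc)
  p : Fin (suc k)
  p = fromℕ< (s≤s (count≤n (P ∘ Fin.suc)))
  toℕp≡c : toℕ p ≡ c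
  toℕp≡c = toℕ-fromℕ< _
  sorts : ∀ x → P x ≡ (toℕ (insert Fin.zero p ρ ⟨$⟩ʳ x) <ᵇ c)
  sorts Fin.zero = begin
    P Fin.zero                              ≡⟨ P₀≡ ⟩
    false                                   ≡⟨ n<ᵇn≡false c ⟨
    c <ᵇ c                                  ≡⟨ cong (_<ᵇ c) toℕp≡c ⟨
    toℕ p <ᵇ c                              ≡⟨ cong (λ q → toℕ q <ᵇ c) (insert-self Fin.zero p ρ) ⟨
    toℕ (insert Fin.zero p ρ ⟨$⟩ʳ Fin.zero) <ᵇ c ∎
    where open ≡-Reasoning
  sorts (Fin.suc x) = begin
    P (Fin.suc x)                           ≡⟨ ρ-sorts x ⟩
    toℕ (ρ ⟨$⟩ʳ x) <ᵇ c                     ≡⟨ cong (toℕ (ρ ⟨$⟩ʳ x) <ᵇ_) toℕp≡c ⟨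
    toℕ (ρ ⟨$⟩ʳ x) <ᵇ toℕ p                 ≡⟨ toℕ-punchIn-<ᵇ p (ρ ⟨$⟩ʳ x) ⟨
    toℕ (punchIn p (ρ ⟨$⟩ʳ x)) <ᵇ toℕ p     ≡⟨ cong (toℕ (punchIn p (ρ ⟨$⟩ʳ x)) <ᵇ_) toℕp≡c ⟩
    toℕ (punchIn p (ρ ⟨$⟩ʳ x)) <ᵇ c         ≡⟨ cong (λ q → toℕ q <ᵇ c) (insert-punchIn Fin.zero p ρ x) ⟨
    toℕ (insert Fin.zero p ρ ⟨$⟩ʳ Fin.suc x) <ᵇ c ∎
    where open ≡-Reasoning

starAdj-leaves : ∀ m {x y} → x ≢ 0 → y ≢ 0 → starAdj m x y ≡ false
starAdj-leaves m {zero}  x≢0 _   = ⊥-elim (x≢0 refl)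
starAdj-leaves m {suc _} {zero}  _ y≢0 = ⊥-elim (y≢0 refl)
starAdj-leaves m {suc _} {suc _} _ _   = refl

-- Degrees and size

module _ {n : ℕ} (G : Graph n) where

  edge< : Fin n → Fin n → ℕ
  edge< i j = b2n (isEdge< G i j)

  adj≡edge<+edge> : ∀ i j → b2n (adj G i j) ≡ edge< i j + edge< j i
  adj≡edge<+edge> i j with <-cmp (toℕ i) (toℕ j)
  ... | tri< i<j _ _ rewrite <⇒<ᵇ≡true i<j | ≤⇒<ᵇ≡false (<⇒≤ i<j) = sym (+-identityʳ _)
  ... | tri> _ _ j<i rewrite <⇒<ᵇ≡true j<i | ≤⇒<ᵇ≡false (<⇒≤ j<i) | adj-sym G i j = refl
  ... | tri≈ _ i≡j _ with refl ← toℕ-injective i≡j rewrite irrefl G i | n<ᵇn≡false (toℕ i) = refl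

  edge<-diag : ∀ c → edge< c c ≡ 0
  edge<-diag c rewrite n<ᵇn≡false (toℕ c) = refl

  deg≡out+in : ∀ i → deg G i ≡ ∑ (edge< i) + ∑ (λ j → edge< j i)
  deg≡out+in i = trans (∑-cong (adj≡edge<+edge> i)) (∑-distrib-+ (edge< i) (λ j → edge< j i))

  isEdge<⇒adj : ∀ i j → isEdge< G i j ≡ true → adj G i j ≡ true
  isEdge<⇒adj i j with toℕ i <ᵇ toℕ j
  ... | true = λ adj≡true → adj≡true

  adj⇒1≤deg : ∀ i j → adj G i j ≡ true → 1 ≤ deg G i
  adj⇒1≤deg i j adj≡true =
    ≤-trans (≤-reflexive (cong b2n (sym adj≡true))) (term≤∑ (λ l → b2n (adj G i l)) j)

  ∑-edges-const : ∀ c → ∑ (λ i → ∑ (λ j → edge< i j * c)) ≡ size G * c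
  ∑-edges-const c = trans (∑-cong (λ i → ∑-distribʳ-* (edge< i) c)) (∑-distribʳ-* (λ i → ∑ (edge< i)) c)

  size≡0⇒Edgeless : size G ≡ 0 → Edgeless G
  size≡0⇒Edgeless size≡0 i j =
    b2n≡0⇒false (trans (adj≡edge<+edge> i j) (cong₂ _+_ (no-edge i j) (no-edge j i)))
    where
    no-edge : ∀ i j → edge< i j ≡ 0
    no-edge i j = ∑≡0⇒≡0 (edge< i) (∑≡0⇒≡0 (λ i → ∑ (edge< i)) size≡0 i) j

  1≤size⇒∃edge : 1 ≤ size G → ∃ λ i → ∃ λ j → isEdge< G i j ≡ true
  1≤size⇒∃edge 1≤size with i , out>0 ← ∑>0⇒∃>0 (λ i → ∑ (edge< i)) 1≤size
                       with j , edge>0 ← ∑>0⇒∃>0 (edge< i) out>0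
                       = i , j , b2n>0⇒true edge>0

module _ {k : ℕ} (G : Graph (suc k)) where

  private
    m : ℕ
    m = size G

  edgesAvoiding : Fin (suc k) → ℕ
  edgesAvoiding c = ∑ λ a → ∑ λ b → edge< G (punchIn c a) (punchIn c b)

  size≡deg+edgesAvoiding : ∀ c → m ≡ deg G c + edgesAvoiding c
  size≡deg+edgesAvoiding c = begin
    m                                             ≡⟨ ∑-remove (λ a → ∑ (edge< G a)) c ⟩
    out + ∑ (λ a → ∑ (edge< G (punchIn c a)))     ≡⟨ cong (out +_) (∑-cong (λ a → ∑-remove (edge< G (punchIn c a)) c)) ⟩
    out + ∑ (λ a → edge< G (punchIn c a) c + ∑ (λ b → edge< G (punchIn c a) (punchIn c b)))
                                                  ≡⟨ cong (out +_) (∑-distrib-+ (λ a → edge< G (punchIn c a) c) _) ⟩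
    out + (in′ + edgesAvoiding c)                 ≡⟨ +-assoc out in′ (edgesAvoiding c) ⟨
    out + in′ + edgesAvoiding c                   ≡⟨ cong (λ t → out + t + edgesAvoiding c) in≡in′ ⟨
    out + ∑ (λ j → edge< G j c) + edgesAvoiding c ≡⟨ cong (_+ edgesAvoiding c) (deg≡out+in G c) ⟨
    deg G c + edgesAvoiding c                     ∎
    where
    open ≡-Reasoning
    out in′ : ℕ
    out = ∑ (edge< G c)
    in′ = ∑ (λ a → edge< G (punchIn c a) c)
    in≡in′ : ∑ (λ j → edge< G j c) ≡ in′
    in≡in′ = trans (∑-remove (λ j → edge< G j c) c) (cong (_+ in′) (edge<-diag G c))

  deg≤size : ∀ i → deg G i ≤ m
  deg≤size i = subst (deg G i ≤_) (sym (size≡deg+edgesAvoiding i)) (m≤m+n _ _)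

  adj⇒∣deg-deg∣≤size∸1 : ∀ i j → adj G i j ≡ true → ∣ deg G i - deg G j ∣ ≤ m ∸ 1
  adj⇒∣deg-deg∣≤size∸1 i j adj≡true =
    ∣x-y∣≤M∸1 (adj⇒1≤deg G i j adj≡true) (deg≤size i)
              (adj⇒1≤deg G j i (trans (adj-sym G j i) adj≡true)) (deg≤size j)

  sigma-term≤ : ∀ i j → edge< G i j * ∣ deg G i - deg G j ∣ ^ 2 ≤ edge< G i j * (m ∸ 1) ^ 2
  sigma-term≤ i j with isEdge< G i j in isEdge
  ... | false = z≤n
  ... | true  = *-monoʳ-≤ 1 (^-monoˡ-≤ 2 (adj⇒∣deg-deg∣≤size∸1 i j (isEdge<⇒adj G i j isEdge)))

  sigma≤size*[size∸1]² : sigma G ≤ m * (m ∸ 1) ^ 2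
  sigma≤size*[size∸1]² = subst (sigma G ≤_) (∑-edges-const G ((m ∸ 1) ^ 2))
    (∑-mono-≤ (λ i → ∑-mono-≤ (sigma-term≤ i)))

  sigma≡⇒edge-extremal : sigma G ≡ m * (m ∸ 1) ^ 2 →
    ∀ i j → isEdge< G i j ≡ true → ∣ deg G i - deg G j ∣ ≡ m ∸ 1
  sigma≡⇒edge-extremal sigma≡ i j isEdge = ^2-injective (begin
    ∣ deg G i - deg G j ∣ ^ 2                  ≡⟨ *-identityˡ _ ⟨
    b2n true * ∣ deg G i - deg G j ∣ ^ 2       ≡⟨ cong (λ b → b2n b * ∣ deg G i - deg G j ∣ ^ 2) isEdge ⟨
    edge< G i j * ∣ deg G i - deg G j ∣ ^ 2    ≡⟨ pointwise-≤∧∑≡⇒≡ (sigma-term≤ i) (rows≡ i) j ⟩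
    edge< G i j * (m ∸ 1) ^ 2                  ≡⟨ cong (λ b → b2n b * (m ∸ 1) ^ 2) isEdge ⟩
    b2n true * (m ∸ 1) ^ 2                     ≡⟨ *-identityˡ _ ⟩
    (m ∸ 1) ^ 2                                ∎)
    where
    open ≡-Reasoning
    rows≡ : ∀ i → ∑ (λ j → edge< G i j * ∣ deg G i - deg G j ∣ ^ 2) ≡ ∑ (λ j → edge< G i j * (m ∸ 1) ^ 2)
    rows≡ = pointwise-≤∧∑≡⇒≡ (λ i → ∑-mono-≤ (sigma-term≤ i))
              (trans sigma≡ (sym (∑-edges-const G ((m ∸ 1) ^ 2))))

  sigma≡⇒∃deg≡size : 1 ≤ m → sigma G ≡ m * (m ∸ 1) ^ 2 → ∃ λ c → deg G c ≡ m
  sigma≡⇒∃deg≡size 1≤m sigma≡ with i , j , isEdge ← 1≤size⇒∃edge G 1≤m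
    with adj≡true ← isEdge<⇒adj G i j isEdge
    with ∣x-y∣≡M∸1⇒x≡M⊎y≡M (adj⇒1≤deg G i j adj≡true) (deg≤size i)
           (adj⇒1≤deg G j i (trans (adj-sym G j i) adj≡true)) (deg≤size j)
           (sigma≡⇒edge-extremal sigma≡ i j isEdge)
  ... | inj₁ degᵢ≡m = i , degᵢ≡m
  ... | inj₂ degⱼ≡m = j , degⱼ≡m

  IsStarCentre : Fin (suc k) → Set
  IsStarCentre c = ∀ a b → adj G (punchIn c a) (punchIn c b) ≡ false

  deg≡size⇒IsStarCentre : ∀ c → deg G c ≡ m → IsStarCentre c
  deg≡size⇒IsStarCentre c deg≡m a b =
    b2n≡0⇒false (trans (adj≡edge<+edge> G (punchIn c a) (punchIn c b)) (cong₂ _+_ (no-edge a b) (no-edge b a)))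
    where
    avoiding≡0 : edgesAvoiding c ≡ 0
    avoiding≡0 = +-cancelˡ-≡ (deg G c) (edgesAvoiding c) 0
      (trans (sym (size≡deg+edgesAvoiding c)) (trans (sym deg≡m) (sym (+-identityʳ _))))
    no-edge : ∀ a b → edge< G (punchIn c a) (punchIn c b) ≡ 0
    no-edge a b = ∑≡0⇒≡0 _ (∑≡0⇒≡0 _ avoiding≡0 a) b

  IsStarCentre⇒deg≡size : ∀ c → IsStarCentre c → deg G c ≡ m
  IsStarCentre⇒deg≡size c isCentre = begin
    deg G c                      ≡⟨ +-identityʳ _ ⟨
    deg G c + 0                  ≡⟨ cong (deg G c +_) avoiding≡0 ⟨
    deg G c + edgesAvoiding c    ≡⟨ size≡deg+edgesAvoiding c ⟨
    m                            ∎
    where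
    open ≡-Reasoning
    no-edge : ∀ a b → edge< G (punchIn c a) (punchIn c b) ≡ 0
    no-edge a b rewrite isCentre a b | ∧-zeroʳ (toℕ (punchIn c a) <ᵇ toℕ (punchIn c b)) = refl
    avoiding≡0 : edgesAvoiding c ≡ 0
    avoiding≡0 = trans (∑-cong (λ a → trans (∑-cong (no-edge a)) (∑-zero k))) (∑-zero k)

  IsStarCentre⇒deg-leaf : ∀ c → IsStarCentre c → ∀ a → deg G (punchIn c a) ≡ b2n (adj G (punchIn c a) c)
  IsStarCentre⇒deg-leaf c isCentre a = begin
    ∑ row                                        ≡⟨ ∑-remove row c ⟩
    row c + ∑ (row ∘ punchIn c)                  ≡⟨ cong (row c +_) (∑-cong (λ b → cong b2n (isCentre a b))) ⟩
    row c + ∑ {k} (λ _ → 0)                      ≡⟨ cong (row c +_) (∑-zero k) ⟩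
    row c + 0                                    ≡⟨ +-identityʳ (row c) ⟩
    row c                                        ∎
    where
    open ≡-Reasoning
    row : Fin (suc k) → ℕ
    row j = b2n (adj G (punchIn c a) j)

  IsStarCentre⇒sigma≡ : ∀ c → IsStarCentre c → 1 ≤ m → sigma G ≡ m * (m ∸ 1) ^ 2
  IsStarCentre⇒sigma≡ c isCentre 1≤m =
    trans (∑-cong (λ i → ∑-cong (sigma-term≡ i))) (∑-edges-const G ((m ∸ 1) ^ 2))
    where
    deg-leaf≡1 : ∀ a → adj G (punchIn c a) c ≡ true → deg G (punchIn c a) ≡ 1
    deg-leaf≡1 a adj≡true = trans (IsStarCentre⇒deg-leaf c isCentre a) (cong b2n adj≡true)
    edge-extremal : ∀ i j → adj G i j ≡ true → ∣ deg G i - deg G j ∣ ≡ m ∸ 1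
    edge-extremal i j adj≡true with punchInView c i | punchInView c j
    ... | here      | here      with () ← trans (sym adj≡true) (irrefl G c)
    ... | punched a | punched b with () ← trans (sym adj≡true) (isCentre a b)
    ... | here      | punched b = trans (cong₂ ∣_-_∣ (IsStarCentre⇒deg≡size c isCentre)
                                          (deg-leaf≡1 b (trans (adj-sym G _ _) adj≡true)))
                                        (m≤n⇒∣n-m∣≡n∸m 1≤m)
    ... | punched a | here      = trans (cong₂ ∣_-_∣ (deg-leaf≡1 a adj≡true) (IsStarCentre⇒deg≡size c isCentre))
                                        (m≤n⇒∣m-n∣≡n∸m 1≤m)
    sigma-term≡ : ∀ i j → edge< G i j * ∣ deg G i - deg G j ∣ ^ 2 ≡ edge< G i j * (m ∸ 1) ^ 2
    sigma-term≡ i j with isEdge< G i j in isEdge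
    ... | false = refl
    ... | true  = cong (λ x → 1 * x ^ 2) (edge-extremal i j (isEdge<⇒adj G i j isEdge))

  IsStarCentre⇒≅Star : ∀ c → IsStarCentre c → G ≅ StarPlusIsolated (suc k) m
  IsStarCentre⇒≅Star c isCentre = π , π-preserves-adj
    where
    neighbour : Fin k → Bool
    neighbour x = adj G c (punchIn c x)
    ρ : Permutation′ k
    ρ = proj₁ (trues-first k neighbour)
    count≡m : count neighbour ≡ m
    count≡m = begin
      count neighbour                                 ≡⟨ cong (_+ count neighbour) (cong b2n (irrefl G c)) ⟨
      b2n (adj G c c) + count neighbour               ≡⟨ ∑-remove (λ j → b2n (adj G c j)) c ⟨
      deg G c                                         ≡⟨ IsStarCentre⇒deg≡size c isCentre ⟩
      m                                               ∎
      where open ≡-Reasoning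
    neighbour≡<ᵇm : ∀ x → neighbour x ≡ (toℕ (ρ ⟨$⟩ʳ x) <ᵇ m)
    neighbour≡<ᵇm x = trans (proj₂ (trues-first k neighbour) x) (cong (toℕ (ρ ⟨$⟩ʳ x) <ᵇ_) count≡m)
    π : Permutation′ (suc k)
    π = insert c Fin.zero ρ
    π-preserves-adj : ∀ a b → adj G a b ≡ starAdj m (toℕ (π ⟨$⟩ʳ a)) (toℕ (π ⟨$⟩ʳ b))
    π-preserves-adj a b with punchInView c a | punchInView c b
    ... | here | here
      rewrite insert-self c Fin.zero ρ = irrefl G c
    ... | here | punched b′
      rewrite insert-self c Fin.zero ρ | insert-punchIn c Fin.zero ρ b′ =
        trans (neighbour≡<ᵇm b′) (sym (∨-identityʳ _))
    ... | punched a′ | here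
      rewrite insert-self c Fin.zero ρ | insert-punchIn c Fin.zero ρ a′ =
        trans (adj-sym G _ _) (neighbour≡<ᵇm a′)
    ... | punched a′ | punched b′
      rewrite insert-punchIn c Fin.zero ρ a′ | insert-punchIn c Fin.zero ρ b′ = isCentre a′ b′

  ≅Star⇒IsStarCentre : (G≅ : G ≅ StarPlusIsolated (suc k) m) → IsStarCentre (proj₁ G≅ ⟨$⟩ˡ Fin.zero)
  ≅Star⇒IsStarCentre (π , π-preserves-adj) a b = trans (π-preserves-adj _ _)
    (starAdj-leaves m (π-leaf≢0 a ∘ toℕ-injective) (π-leaf≢0 b ∘ toℕ-injective))
    where
    c : Fin (suc k)
    c = π ⟨$⟩ˡ Fin.zero
    π-leaf≢0 : ∀ a → π ⟨$⟩ʳ punchIn c a ≢ Fin.zero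
    π-leaf≢0 a πa≡0 = punchInᵢ≢i c a (trans (sym (inverseˡ π)) (cong (π ⟨$⟩ˡ_) πa≡0))

lemma2p1 : (n : ℕ) (G : Graph n) → size G ≤ n ∸ 1 →
    (sigma G ≤ size G * (size G ∸ 1) ^ 2)
    × ((sigma G ≡ size G * (size G ∸ 1) ^ 2) ⇔
       ((size G ≡ 0 × Edgeless G) ⊎ (1 ≤ size G × G ≅ StarPlusIsolated n (size G))))
lemma2p1 zero    G _ = z≤n , mk⇔ (λ _ → inj₁ (refl , λ ())) (λ _ → refl)
lemma2p1 (suc k) G _ = sigma≤size*[size∸1]² G , mk⇔ extremal⇒star star⇒extremal
  where
  m : ℕ
  m = size G
  extremal⇒star : sigma G ≡ m * (m ∸ 1) ^ 2 →
    (m ≡ 0 × Edgeless G) ⊎ (1 ≤ m × G ≅ StarPlusIsolated (suc k) m)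
  extremal⇒star sigma≡ with m ≟ 0
  ... | yes m≡0 = inj₁ (m≡0 , size≡0⇒Edgeless G m≡0)
  ... | no m≢0 with c , deg≡m ← sigma≡⇒∃deg≡size G (n≢0⇒n>0 m≢0) sigma≡ =
    inj₂ (n≢0⇒n>0 m≢0 , IsStarCentre⇒≅Star G c (deg≡size⇒IsStarCentre G c deg≡m))
  star⇒extremal : (m ≡ 0 × Edgeless G) ⊎ (1 ≤ m × G ≅ StarPlusIsolated (suc k) m) →
    sigma G ≡ m * (m ∸ 1) ^ 2
  star⇒extremal (inj₁ (m≡0 , _)) = subst (λ t → sigma G ≡ t * (t ∸ 1) ^ 2) (sym m≡0)
    (n≤0⇒n≡0 (subst (λ t → sigma G ≤ t * (t ∸ 1) ^ 2) m≡0 (sigma≤size*[size∸1]² G)))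
  star⇒extremal (inj₂ (1≤m , G≅)) = IsStarCentre⇒sigma≡ G _ (≅Star⇒IsStarCentre G G≅) 1≤m
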